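{- Let $G$ be a graph without isolated vertices, with edge density $\epsilon=|E(G)|/|G|$, and let $\beta(G)$ be the minimum size of a vertex cover of $G$. (i) If $\tau$ is any threshold assignment for $G$ with average threshold $2\epsilon$, then every $\tau$-dynamic monopoly has at least $\beta(G)$ vertices; in particular $Dyn_{\bar t=2\epsilon}(G)=\beta(G)$. (ii) For any constant $t\le 2\epsilon$ (for which some threshold assignment of $G$ with average $t$ exists), $Dyn_{\bar t=t}(G)\le \beta(G)$.
   Context: Graphs are finite, undirected, simple. A threshold assignment for $G$ is a function $\tau:V(G)\to\mathbb{N}\cup\{0\}$ with $\tau(v)\le \deg(v)$ for every $v$; its average threshold is $\bar\tau=\sum_{v}\tau(v)/|G|$. For $M\subseteq V(G)$, the $\tau$-dynamic process starting from $M$ is $D_0=M$ and, for $i\ge0$, $D_{i+1}$ = set of vertices $v\notin D_0\cup\dots\cup D_i$ with at least $\tau(v)$ neighbours in $D_0\cup\dots\cup D_i$; $M$ is a $\tau$-dynamic monopoly if $\bigcup_i D_i=V(G)$. $dyn_\tau(G)$ is the minimum size of a $\tau$-dynamic monopoly, and $Dyn_{\bar t=t}(G)=\max\{dyn_\tau(G):\tau \text{ a threshold assignment with } \bar\tau=t\}$. A vertex cover is a set $S\subseteq V(G)$ meeting every edge. -}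

module Defs where

open import Data.Nat using (ℕ; zero; suc; _+_; _*_; _≤_; _<_)
open import Data.Bool using (Bool; true; false; if_then_else_; _∧_)
open import Data.Fin using (Fin; zero; suc)
import Data.Fin as F
open import Data.Fin.Subset using (Subset; ∣_∣; ⊤; _∈_)
open import Data.Vec using (lookup; tabulate)
open import Data.Product using (Σ; ∃; _×_; _,_)
open import Data.Sum using (_⊎_)
open import Relation.Binary.PropositionalEquality using (_≡_)
open import Relation.Nullary.Decidable using (⌊_⌋)
open import Function using (_∘_)

sumF : ∀ {n} → (Fin n → ℕ) → ℕ
sumF {zero}  f = 0
sumF {suc n} f = f zero + sumF (f ∘ suc)

b2n : Bool → ℕ
b2n true  = 1
b2n false = 0

record Graph (n : ℕ) : Set where
  field
    adj     : Fin n → Fin n → Bool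
    adj-sym : ∀ i j → adj i j ≡ adj j i
    irrefl  : ∀ i → adj i i ≡ false
open Graph public

module _ {n : ℕ} (G : Graph n) where

  deg : Fin n → ℕ
  deg v = sumF (λ j → b2n (adj G v j))

  edges : ℕ
  edges = sumF (λ i → sumF (λ j → b2n (⌊ i F.<? j ⌋ ∧ adj G i j)))

  NoIsolated : Set
  NoIsolated = ∀ v → ∃ λ w → adj G v w ≡ true

  IsThreshold : (Fin n → ℕ) → Set
  IsThreshold τ = ∀ v → τ v ≤ deg v

  nbrsIn : Subset n → Fin n → ℕ
  nbrsIn A v = sumF (λ j → b2n (adj G v j ∧ lookup A j))

  -- one round of the process: D_0 ∪ … ∪ D_{i+1} from D_0 ∪ … ∪ D_i
  step : (Fin n → ℕ) → Subset n → Subset n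
  step τ A = tabulate (λ v → if lookup A v then true else ⌊ τ v Data.Nat.≤? nbrsIn A v ⌋)
    where import Data.Nat

  iter : (Fin n → ℕ) → ℕ → Subset n → Subset n
  iter τ zero    A = A
  iter τ (suc k) A = step τ (iter τ k A)

  IsDynMonopoly : (Fin n → ℕ) → Subset n → Set
  IsDynMonopoly τ M = ∃ λ k → iter τ k M ≡ ⊤

  DynIs : (Fin n → ℕ) → ℕ → Set
  DynIs τ k = (∃ λ M → IsDynMonopoly τ M × ∣ M ∣ ≡ k)
            × (∀ M → IsDynMonopoly τ M → k ≤ ∣ M ∣)

  IsVertexCover : Subset n → Set
  IsVertexCover S = ∀ i j → adj G i j ≡ true → i ∈ S ⊎ j ∈ S

  MinVertexCoverIs : ℕ → Set
  MinVertexCoverIs b = (∃ λ S → IsVertexCover S × ∣ S ∣ ≡ b)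
                     × (∀ S → IsVertexCover S → b ≤ ∣ S ∣)

-- A vertex with threshold τ v ≥ deg v that is not in M only becomes active after
-- all of its neighbours, so the endpoint of an edge that is activated first (or
-- either one, if they are activated together) lies in M: for such τ every dynamic
-- monopoly is a vertex cover. By the handshake lemma the only threshold assignment
-- with total 2|E| is τ = deg. Conversely a vertex cover S is a dynamic monopoly for
-- every threshold assignment, finishing in one round because each vertex outside S
-- has all its neighbours in S.
module Submission where

open import Defs
open import Data.Nat using (ℕ; zero; suc; _+_; _*_; _≤_; _<_; _≤?_; z≤n)
open import Data.Nat.Properties
  using (≤-refl; ≤-trans; ≤-reflexive; <⇒≱; m≤n⇒m<n∨m≡n;
         +-mono-≤; +-mono-<-≤; +-mono-≤-<; +-identityʳ; +-commutativeSemigroup)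
open import Algebra.Properties.CommutativeSemigroup +-commutativeSemigroup using (interchange)
open import Data.Bool using (true; false; _∧_; if_then_else_)
open import Data.Fin using (Fin; zero; suc)
import Data.Fin as Fin
import Data.Fin.Properties as Fin
open import Data.Fin.Subset using (Subset; ∣_∣)
open import Data.Vec using (lookup)
open import Data.Vec.Relation.Binary.Pointwise.Extensional using (ext; Pointwise-≡⇒≡)
open import Data.Vec.Properties
  using (lookup∘tabulate; lookup-replicate; []=⇒lookup; lookup⇒[]=)
open import Data.Product using (∃; _×_; _,_; proj₂)
open import Data.Sum using (_⊎_; inj₁; inj₂; map₂)
open import Data.Empty using (⊥-elim)
open import Function using (_∘_)
open import Relation.Nullary using (yes; no; contradiction)
open import Relation.Nullary.Decidable using (⌊_⌋)
open import Relation.Binary.Definitions using (tri<; tri≈; tri>)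
open import Relation.Binary.PropositionalEquality
  using (_≡_; refl; sym; trans; cong; cong₂; subst; subst₂; module ≡-Reasoning)

sumF-cong : ∀ {n} {f g : Fin n → ℕ} → (∀ i → f i ≡ g i) → sumF f ≡ sumF g
sumF-cong {zero}  f≗g = refl
sumF-cong {suc n} f≗g = cong₂ _+_ (f≗g zero) (sumF-cong (f≗g ∘ suc))

sumF-mono-≤ : ∀ {n} {f g : Fin n → ℕ} → (∀ i → f i ≤ g i) → sumF f ≤ sumF g
sumF-mono-≤ {zero}  f≤g = z≤n
sumF-mono-≤ {suc n} f≤g = +-mono-≤ (f≤g zero) (sumF-mono-≤ (f≤g ∘ suc))

sumF-mono-< : ∀ {n} {f g : Fin n → ℕ} → (∀ i → f i ≤ g i) → ∀ i → f i < g i → sumF f < sumF g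
sumF-mono-< f≤g zero    fi<gi = +-mono-<-≤ fi<gi (sumF-mono-≤ (f≤g ∘ suc))
sumF-mono-< f≤g (suc i) fi<gi = +-mono-≤-< (f≤g zero) (sumF-mono-< (f≤g ∘ suc) i fi<gi)

sumF-≤-tight : ∀ {n} {f g : Fin n → ℕ} → (∀ i → f i ≤ g i) → sumF g ≤ sumF f → ∀ i → f i ≡ g i
sumF-≤-tight f≤g Σg≤Σf i with m≤n⇒m<n∨m≡n (f≤g i)
... | inj₁ fi<gi = contradiction Σg≤Σf (<⇒≱ (sumF-mono-< f≤g i fi<gi))
... | inj₂ fi≡gi = fi≡gi

sumF-zero : ∀ n → sumF {n} (λ _ → 0) ≡ 0
sumF-zero zero    = refl
sumF-zero (suc n) = sumF-zero n

sumF-+ : ∀ {n} (f g : Fin n → ℕ) → sumF (λ i → f i + g i) ≡ sumF f + sumF g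
sumF-+ {zero}  f g = refl
sumF-+ {suc n} f g =
  trans (cong (f zero + g zero +_) (sumF-+ (f ∘ suc) (g ∘ suc)))
        (interchange (f zero) (g zero) (sumF (f ∘ suc)) (sumF (g ∘ suc)))

sumF-comm : ∀ {m n} (f : Fin m → Fin n → ℕ) →
            sumF (λ i → sumF (f i)) ≡ sumF (λ j → sumF (λ i → f i j))
sumF-comm {zero}  {n} f = sym (sumF-zero n)
sumF-comm {suc m} f = trans (cong (sumF (f zero) +_) (sumF-comm (f ∘ suc)))
                            (sym (sumF-+ (f zero) (λ j → sumF (λ i → f (suc i) j))))

b2n-∧ : ∀ a b → b2n (a ∧ b) ≤ b2n a
b2n-∧ true  true  = ≤-refl
b2n-∧ true  false = z≤n
b2n-∧ false b     = z≤n

module _ {n : ℕ} (G : Graph n) where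

  private
    forward : Fin n → Fin n → ℕ
    forward i j = b2n (⌊ i Fin.<? j ⌋ ∧ adj G i j)

  adj-split : ∀ i j → b2n (adj G i j) ≡ forward i j + forward j i
  adj-split i j with i Fin.<? j | j Fin.<? i
  ... | yes i<j | yes j<i = ⊥-elim (Fin.<-asym i<j j<i)
  ... | yes _   | no _    = sym (+-identityʳ _)
  ... | no _    | yes _   = cong b2n (adj-sym G i j)
  ... | no i≮j  | no j≮i  with Fin.<-cmp i j
  ...   | tri< i<j _    _   = ⊥-elim (i≮j i<j)
  ...   | tri> _   _    j<i = ⊥-elim (j≮i j<i)
  ...   | tri≈ _   refl _   = cong b2n (irrefl G i)

  handshake : sumF (deg G) ≡ 2 * edges G
  handshake = begin
    sumF (λ i → sumF (λ j → b2n (adj G i j)))                       ≡⟨ sumF-cong (λ i → sumF-cong (adj-split i)) ⟩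
    sumF (λ i → sumF (λ j → forward i j + forward j i))             ≡⟨ sumF-cong (λ i → sumF-+ (forward i) (λ j → forward j i)) ⟩
    sumF (λ i → sumF (forward i) + sumF (λ j → forward j i))        ≡⟨ sumF-+ (λ i → sumF (forward i)) (λ i → sumF (λ j → forward j i)) ⟩
    edges G + sumF (λ i → sumF (λ j → forward j i))                 ≡⟨ cong (edges G +_) (sym (sumF-comm forward)) ⟩
    edges G + edges G                                               ≡⟨ cong (edges G +_) (sym (+-identityʳ (edges G))) ⟩
    2 * edges G                                                     ∎
    where open ≡-Reasoning

  threshold≡deg : ∀ τ → IsThreshold G τ → sumF τ ≡ 2 * edges G → ∀ v → τ v ≡ deg G v
  threshold≡deg τ τ≤deg Στ≡2e = sumF-≤-tight τ≤deg (≤-reflexive (trans handshake (sym Στ≡2e)))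

  deg≤nbrsIn⇒neighbours∈ : ∀ A v → deg G v ≤ nbrsIn G A v →
                           ∀ {w} → adj G v w ≡ true → lookup A w ≡ true
  deg≤nbrsIn⇒neighbours∈ A v deg≤ {w} vw with lookup A w in Aw
  ... | true  = refl
  ... | false = contradiction (subst₂ (λ a b → b2n (a ∧ b) ≡ b2n a) vw Aw tight) λ ()
    where
    tight : b2n (adj G v w ∧ lookup A w) ≡ b2n (adj G v w)
    tight = sumF-≤-tight (λ j → b2n-∧ (adj G v j) (lookup A j)) deg≤ w

  cover⇒deg≤nbrsIn : ∀ S → IsVertexCover G S → ∀ v → lookup S v ≡ false → deg G v ≤ nbrsIn G S v
  cover⇒deg≤nbrsIn S cover v v∉S = sumF-mono-≤ edge-covered
    where
    edge-covered : ∀ j → b2n (adj G v j) ≤ b2n (adj G v j ∧ lookup S j)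
    edge-covered j with adj G v j in vj
    ... | false = z≤n
    ... | true with cover v j vj
    ...   | inj₁ v∈S = contradiction (trans (sym v∉S) ([]=⇒lookup v∈S)) λ ()
    ...   | inj₂ j∈S rewrite []=⇒lookup j∈S = ≤-refl

  lookup-step : ∀ τ A v → lookup (step G τ A) v ≡ (if lookup A v then true else ⌊ τ v ≤? nbrsIn G A v ⌋)
  lookup-step τ A v = lookup∘tabulate _ v

  step-⊇ : ∀ τ A {v} → lookup A v ≡ true → lookup (step G τ A) v ≡ true
  step-⊇ τ A {v} Av rewrite lookup-step τ A v | Av = refl

  step-entering : ∀ τ A {v} → lookup (step G τ A) v ≡ true → lookup A v ≡ false → τ v ≤ nbrsIn G A v
  step-entering τ A {v} stepv Av rewrite lookup-step τ A v | Av with τ v ≤? nbrsIn G A v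
  ... | yes τ≤ = τ≤
  ... | no _   = contradiction stepv λ ()

  cover⇒monopoly : ∀ τ → IsThreshold G τ → ∀ S → IsVertexCover G S → IsDynMonopoly G τ S
  cover⇒monopoly τ τ≤deg S cover = 1 , Pointwise-≡⇒≡ (ext λ v → trans (activated v) (sym (lookup-replicate v true)))
    where
    activated : ∀ v → lookup (step G τ S) v ≡ true
    activated v with lookup S v in Sv
    ... | true  = step-⊇ τ S Sv
    ... | false rewrite lookup-step τ S v | Sv with τ v ≤? nbrsIn G S v
    ...   | yes _  = refl
    ...   | no τ≰ = contradiction (≤-trans (τ≤deg v) (cover⇒deg≤nbrsIn S cover v Sv)) τ≰

  module DegreeThresholds (τ : Fin n → ℕ) (deg≤τ : ∀ v → deg G v ≤ τ v) (M : Subset n) where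

    Closed : Subset n → Set
    Closed A = ∀ {u v} → adj G u v ≡ true → lookup A u ≡ true → lookup M u ≡ true ⊎ lookup A v ≡ true

    CoveredWithin : Subset n → Set
    CoveredWithin A = ∀ {u v} → adj G u v ≡ true → lookup A u ≡ true → lookup A v ≡ true →
                      lookup M u ≡ true ⊎ lookup M v ≡ true

    entering⇒neighbours∈ : ∀ A {u v} → adj G u v ≡ true →
                           lookup (step G τ A) u ≡ true → lookup A u ≡ false → lookup A v ≡ true
    entering⇒neighbours∈ A uv stepu Au =
      deg≤nbrsIn⇒neighbours∈ A _ (≤-trans (deg≤τ _) (step-entering τ A stepu Au)) uv

    closed-step : ∀ A → Closed A → Closed (step G τ A)
    closed-step A closed {u} uv stepu with lookup A u in Au
    ... | true  = map₂ (step-⊇ τ A) (closed uv Au)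
    ... | false = inj₂ (step-⊇ τ A (entering⇒neighbours∈ A uv stepu Au))

    entering⇒neighbour∈M : ∀ A → Closed A → ∀ {u v} → adj G u v ≡ true →
                           lookup (step G τ A) u ≡ true → lookup A u ≡ false → lookup M v ≡ true
    entering⇒neighbour∈M A closed {u} {v} uv stepu Au
      with closed (trans (adj-sym G v u) uv) (entering⇒neighbours∈ A uv stepu Au)
    ... | inj₁ Mv = Mv
    ... | inj₂ Au′ = contradiction (trans (sym Au) Au′) λ ()

    covered-step : ∀ A → Closed A → CoveredWithin A → CoveredWithin (step G τ A)
    covered-step A closed covered {u} {v} uv stepu stepv with lookup A u in Au | lookup A v in Av
    ... | true  | true  = covered uv Au Av
    ... | false | _     = inj₂ (entering⇒neighbour∈M A closed uv stepu Au)
    ... | true  | false = inj₁ (entering⇒neighbour∈M A closed (trans (adj-sym G v u) uv) stepv Av)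

    iter-invariant : ∀ k → Closed (iter G τ k M) × CoveredWithin (iter G τ k M)
    iter-invariant zero    = (λ _ Mu → inj₁ Mu) , (λ _ Mu _ → inj₁ Mu)
    iter-invariant (suc k) with iter-invariant k
    ... | closed , covered = closed-step A closed , covered-step A closed covered
      where A = iter G τ k M

    monopoly⇒cover : IsDynMonopoly G τ M → IsVertexCover G M
    monopoly⇒cover (k , iter≡⊤) u v uv with proj₂ (iter-invariant k) uv (active u) (active v)
      where
      active : ∀ w → lookup (iter G τ k M) w ≡ true
      active w = trans (cong (λ A → lookup A w) iter≡⊤) (lookup-replicate w true)
    ... | inj₁ Mu = inj₁ (lookup⇒[]= u M Mu)
    ... | inj₂ Mv = inj₂ (lookup⇒[]= v M Mv)

proposition1 : ∀ {n} (G : Graph n) → NoIsolated G → (b : ℕ) → MinVertexCoverIs G b →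
    ((∀ τ → IsThreshold G τ → sumF τ ≡ 2 * edges G → ∀ M → IsDynMonopoly G τ M → b ≤ ∣ M ∣)
    × ((∃ λ τ → IsThreshold G τ × sumF τ ≡ 2 * edges G × DynIs G τ b)
    × (∀ τ → IsThreshold G τ → sumF τ ≡ 2 * edges G → ∀ k → DynIs G τ k → k ≤ b)))
    × (∀ p q → 0 < q → p * n ≤ q * (2 * edges G) →
    ∀ τ → IsThreshold G τ → q * sumF τ ≡ p * n → ∀ k → DynIs G τ k → k ≤ b)
-- Isolated vertices do no harm.
proposition1 G _ b ((S , S-cover , ∣S∣≡b) , β-min) =
  (monopoly-size , (deg-witness , λ τ τ-thr _ → dyn≤β τ τ-thr)) , λ _ _ _ _ τ τ-thr _ → dyn≤β τ τ-thr
  where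
  monopoly-size : ∀ τ → IsThreshold G τ → sumF τ ≡ 2 * edges G → ∀ M → IsDynMonopoly G τ M → b ≤ ∣ M ∣
  monopoly-size τ τ-thr Στ≡2e M monopoly = β-min M (DegreeThresholds.monopoly⇒cover G τ deg≤τ M monopoly)
    where
    deg≤τ : ∀ v → deg G v ≤ τ v
    deg≤τ v = ≤-reflexive (sym (threshold≡deg G τ τ-thr Στ≡2e v))

  dyn≤β : ∀ τ → IsThreshold G τ → ∀ k → DynIs G τ k → k ≤ b
  dyn≤β τ τ-thr k (_ , dyn-min) = subst (k ≤_) ∣S∣≡b (dyn-min S (cover⇒monopoly G τ τ-thr S S-cover))

  deg-witness : ∃ λ τ → IsThreshold G τ × sumF τ ≡ 2 * edges G × DynIs G τ b
  deg-witness = deg G , (λ _ → ≤-refl) , handshake G ,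
                (S , cover⇒monopoly G (deg G) (λ _ → ≤-refl) S S-cover , ∣S∣≡b) ,
                monopoly-size (deg G) (λ _ → ≤-refl) (handshake G)
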